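{- Let $S\subseteq\mathbb{Z}_2^n\setminus\{0\}$. Then: (1) $q_0(\emptyset)=1$, $q_0(\{x\})=1/2$ for every non-zero $x$, and $q_0(S)\le1/4$ for every $S$ with $|S|\ge2$; (2) if $m(S)=0$ and $|S|$ is odd, then either $q_0(S)\le1/16$, or $S$ is of one of the forms $\{x,y,x+y\}$, $\{x,y,z,x+y,x+z\}$, or $\{x,y,z,x+y,y+z,x+z,x+y+z\}$; (3) either $J(S)=\emptyset$, or $q_0(J(S))\le1/4$.
   Context: $\langle x,y\rangle=\sum_i x_iy_i$ on $\mathbb{Z}_2^n$. Let $w$ be uniformly random in $\mathbb{Z}_2^n$ and $A_w=\{v:\langle v,w\rangle=1\}$; $q_0(S)=\Pr[S\cap A_w=\emptyset]$. $I(S)=\{v\in S: v\notin\mathrm{Span}(S\setminus\{v\})\}$, $m(S)=|I(S)|$, and $J(S)=S\setminus I(S)$ (the union of the linearly dependent subsets of $S$). -}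

module Defs where

open import Data.Bool using (Bool; true; false; _xor_; _∧_; not)
open import Data.Bool.Properties using () renaming (_≟_ to _≟ᵇ_)
open import Data.Nat using (ℕ; zero; suc; _^_)
open import Data.Nat.Properties using (m^n≢0)
open import Data.Integer using (+_)
open import Data.Rational using (ℚ; _/_)
open import Data.Vec using (Vec; []; _∷_; zipWith; replicate; foldr)
open import Data.Vec.Properties using (≡-dec)
open import Data.List as L using (List; _++_; map; filter; length)
import Data.List.Membership.DecPropositional as DecMem
open import Relation.Nullary using (¬?)
open import Relation.Binary using (DecidableEquality)
open import Relation.Binary.PropositionalEquality using (_≡_)

-- Vectors of Z_2^n, coordinates in Bool (true = 1), addition = xor.
V : ℕ → Set
V n = Vec Bool n

_≟V_ : ∀ {n} → DecidableEquality (V n)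
_≟V_ = ≡-dec _≟ᵇ_

𝟘 : ∀ {n} → V n
𝟘 = replicate _ false

infixl 6 _+V_
_+V_ : ∀ {n} → V n → V n → V n
_+V_ = zipWith _xor_

⟨_,_⟩ : ∀ {n} → V n → V n → Bool
⟨ x , y ⟩ = foldr _ _xor_ false (zipWith _∧_ x y)

allV : (n : ℕ) → List (V n)
allV zero = [] L.∷ L.[]
allV (suc n) = map (false ∷_) (allV n) ++ map (true ∷_) (allV n)

-- S ∩ A_w = ∅  iff  ⟨v,w⟩ = 0 for all v ∈ S
disjointA : ∀ {n} → List (V n) → V n → Bool
disjointA L.[] w = true
disjointA (v L.∷ S) w = not ⟨ v , w ⟩ ∧ disjointA S w

countDisj : ∀ {n} → List (V n) → ℕ
countDisj {n} S = length (filter (λ w → disjointA S w ≟ᵇ true) (allV n))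

q0 : ∀ {n} → List (V n) → ℚ
q0 {n} S = _/_ (+ countDisj S) (2 ^ n) {{m^n≢0 2 n}}

spanList : ∀ {n} → List (V n) → List (V n)
spanList L.[] = 𝟘 L.∷ L.[]
spanList (t L.∷ T) = spanList T ++ map (t +V_) (spanList T)

module _ {n : ℕ} where
  open DecMem (_≟V_ {n}) using (_∈?_)

  remove : V n → List (V n) → List (V n)
  remove v S = filter (λ u → ¬? (u ≟V v)) S

  I : List (V n) → List (V n)
  I S = filter (λ v → ¬? (v ∈? spanList (remove v S))) S

  J : List (V n) → List (V n)
  J S = filter (λ v → v ∈? spanList (remove v S)) S

  m : List (V n) → ℕ
  m S = length (I S)

-- If a ∉ Span(T), some u has ⟨a,u⟩ = 1 and
-- vanishes on T, and translation by u exchanges the w with ⟨a,w⟩ = 0 and ⟨a,w⟩ = 1 among those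
-- vanishing on T; so adding a halves the count, q0(T) = 2^-|T| for independent T, and q0 is antitone.
-- Two distinct nonzero vectors are independent, which gives (1), and also (3): if v ∈ Span(S \ {v}),
-- exchanging v against a vector u of that dependency shows u ∈ J(S) too. For (2), a basis of S with
-- at least four vectors gives q0(S) ≤ 1/16. Otherwise S lies in the span of three vectors, so it has
-- at most seven elements; three elements with m(S) = 0 are {x, y, x + y}, and five or seven elements
-- are described through their coordinates in 𝔽₂³, where the possible shapes are checked exhaustively.
module Submission where

open import Defs
open import Data.Bool using (Bool; true; false; _xor_; _∧_; not; if_then_else_)
open import Data.Bool.Properties
  using (xor-assoc; xor-comm; xor-same; xor-identityʳ; true-xor; not-involutive; ∧-comm; ∧-distribˡ-xor;
         xor-∧-commutativeRing)
  renaming (_≟_ to _≟ᵇ_)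
open import Data.Nat using (ℕ; zero; suc; _+_; _*_; _^_; _%_; z≤n; s≤s)
import Data.Nat as ℕ
open import Data.Nat.Properties as ℕP using (≤-refl; ≤-reflexive; +-comm; *-assoc)
open import Data.Integer using (+_)
open import Data.Rational using (_/_; _≤_; 1ℚ; ½)
open import Data.Rational.Properties using (toℚᵘ-injective; toℚᵘ-fromℚᵘ; toℚᵘ-cancel-≤)
open import Data.Rational.Unnormalised using (mkℚᵘ; *≡*; *≤*)
import Data.Rational.Unnormalised.Properties as ℚᵘP
import Data.Integer as ℤ
import Data.Integer.Properties as ℤP
open import Data.Vec using (Vec; []; _∷_; toList)
open import Data.List as List using (List; []; _∷_; _++_; map; filter; length)
open import Data.List.Properties using (length-++; length-map; filter-++; filter-all; filter-reject)
open import Data.List.Membership.Propositional using (_∈_; _∉_; find)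
open import Data.List.Membership.Propositional.Properties
  using (∈-∃++; ∈-++⁺ˡ; ∈-++⁺ʳ; ∈-++⁻; ∈-map⁺; ∈-map⁻; ∈-filter⁺; ∈-filter⁻; ∈-length)
open import Data.List.Relation.Binary.Subset.Propositional using (_⊆_)
open import Data.List.Relation.Unary.Any using (here; there)
open import Data.List.Relation.Unary.All as All using (All; []; _∷_; all?)
open import Data.List.Relation.Unary.All.Properties using (¬All⇒Any¬) renaming (map⁻ to All-map⁻)
open import Data.List.Relation.Unary.AllPairs using ([]; _∷_)
open import Data.List.Relation.Unary.Unique.Propositional using (Unique)
import Data.List.Relation.Unary.Unique.Propositional.Properties as UniqP
open import Data.List.Relation.Binary.Permutation.Propositional using (_↭_; ↭-trans; ↭-sym; prep)
open import Data.List.Relation.Binary.Permutation.Propositional.Properties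
  using (shift) renaming (map⁺ to ↭-map⁺)
open import Data.Product using (_×_; _,_; ∃-syntax; proj₁)
open import Data.Sum as Sum using (_⊎_; inj₁; inj₂; [_,_]′)
open import Function using (_∘_)
open import Relation.Nullary using (Dec; yes; no; ¬?; contradiction)
open import Relation.Nullary.Decidable using (from-yes; _→-dec_)
open import Data.Maybe using (fromMaybe)
open import Relation.Binary using (DecidableEquality)
open import Relation.Binary.PropositionalEquality hiding (J)
open import Algebra.Bundles using (CommutativeRing)
open import Algebra.Properties.CommutativeSemigroup
  (CommutativeRing.+-commutativeSemigroup xor-∧-commutativeRing)
  using () renaming (interchange to xor-interchange)
open import Algebra.Properties.CommutativeSemigroup ℕP.+-commutativeSemigroup
  using () renaming (interchange to +-interchange)

module _ {A : Set} where

  ∈-extract : ∀ {v : A} {xs} → v ∈ xs →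
    ∃[ ys ] (xs ↭ v ∷ ys × length xs ≡ suc (length ys) × (∀ {w} → w ∈ xs → w ≢ v → w ∈ ys))
  ∈-extract {v} v∈xs with ys , zs , refl ← ∈-∃++ v∈xs =
    ys ++ zs , shift v ys zs , length-shift , keep
    where
      length-shift : length (ys ++ v ∷ zs) ≡ suc (length (ys ++ zs))
      length-shift = begin
        length (ys ++ v ∷ zs)       ≡⟨ length-++ ys ⟩
        length ys + suc (length zs) ≡⟨ ℕP.+-suc (length ys) (length zs) ⟩
        suc (length ys + length zs) ≡⟨ cong suc (length-++ ys) ⟨
        suc (length (ys ++ zs))     ∎
        where open ≡-Reasoning
      keep : ∀ {w} → w ∈ ys ++ v ∷ zs → w ≢ v → w ∈ ys ++ zs
      keep w∈ w≢v with ∈-++⁻ ys w∈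
      ... | inj₁ w∈ys         = ∈-++⁺ˡ w∈ys
      ... | inj₂ (here w≡v)   = contradiction w≡v w≢v
      ... | inj₂ (there w∈zs) = ∈-++⁺ʳ ys w∈zs

  Unique-⊆⇒length≤ : ∀ {xs ys : List A} → Unique xs → xs ⊆ ys → length xs ℕ.≤ length ys
  Unique-⊆⇒length≤ {[]} _ _ = z≤n
  Unique-⊆⇒length≤ {x ∷ xs} (x∉xs ∷ uxs) xs⊆ys with _ , _ , len , keep ← ∈-extract (xs⊆ys (here refl)) =
    subst (suc (length xs) ℕ.≤_) (sym len)
      (s≤s (Unique-⊆⇒length≤ uxs λ w∈ → keep (xs⊆ys (there w∈)) λ w≡x → All.lookup x∉xs w∈ (sym w≡x)))

  Unique-⊆⇒↭ : ∀ {xs ys : List A} → Unique xs → xs ⊆ ys → length ys ℕ.≤ length xs → xs ↭ ys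
  Unique-⊆⇒↭ {[]} {[]} _ _ _ = _↭_.refl
  Unique-⊆⇒↭ {x ∷ xs} (x∉xs ∷ uxs) xs⊆ys len≤ with _ , ys↭ , len , keep ← ∈-extract (xs⊆ys (here refl)) =
    ↭-trans (prep x (Unique-⊆⇒↭ uxs (λ w∈ → keep (xs⊆ys (there w∈)) λ w≡x → All.lookup x∉xs w∈ (sym w≡x))
                                     (ℕ.s≤s⁻¹ (subst (ℕ._≤ suc (length xs)) len len≤))))
            (↭-sym ys↭)

  module _ (_≟_ : DecidableEquality A) where

    open import Data.List.Membership.DecPropositional _≟_ using (_∈?_)

    ∃-∉-of-longer : ∀ {xs ys : List A} → Unique xs → length ys ℕ.< length xs → ∃[ x ] (x ∈ xs × x ∉ ys)
    ∃-∉-of-longer {xs} {ys} uxs ys<xs with all? (_∈? ys) xs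
    ... | yes xs⊆ys = contradiction (Unique-⊆⇒length≤ uxs (All.lookup xs⊆ys)) (ℕP.<⇒≱ ys<xs)
    ... | no  xs⊈ys = find (¬All⇒Any¬ (_∈? ys) xs xs⊈ys)

+V-assoc : ∀ {n} (x y z : V n) → (x +V y) +V z ≡ x +V (y +V z)
+V-assoc []      []      []      = refl
+V-assoc (a ∷ x) (b ∷ y) (c ∷ z) = cong₂ _∷_ (xor-assoc a b c) (+V-assoc x y z)

+V-comm : ∀ {n} (x y : V n) → x +V y ≡ y +V x
+V-comm []      []      = refl
+V-comm (a ∷ x) (b ∷ y) = cong₂ _∷_ (xor-comm a b) (+V-comm x y)

+V-identityˡ : ∀ {n} (x : V n) → 𝟘 +V x ≡ x
+V-identityˡ []      = refl
+V-identityˡ (a ∷ x) = cong (a ∷_) (+V-identityˡ x)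

+V-identityʳ : ∀ {n} (x : V n) → x +V 𝟘 ≡ x
+V-identityʳ x = trans (+V-comm x 𝟘) (+V-identityˡ x)

+V-self : ∀ {n} (x : V n) → x +V x ≡ 𝟘
+V-self []      = refl
+V-self (a ∷ x) = cong₂ _∷_ (xor-same a) (+V-self x)

+V-cancelʳ : ∀ {n} (x y : V n) → (x +V y) +V y ≡ x
+V-cancelʳ x y = begin
  (x +V y) +V y ≡⟨ +V-assoc x y y ⟩
  x +V (y +V y) ≡⟨ cong (x +V_) (+V-self y) ⟩
  x +V 𝟘        ≡⟨ +V-identityʳ x ⟩
  x             ∎
  where open ≡-Reasoning

+V-interchange : ∀ {n} (p q r s : V n) → (p +V q) +V (r +V s) ≡ (p +V r) +V (q +V s)
+V-interchange []      []      []      []      = refl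
+V-interchange (a ∷ p) (b ∷ q) (c ∷ r) (d ∷ s) = cong₂ _∷_ (xor-interchange a b c d) (+V-interchange p q r s)

⟨⟩-comm : ∀ {n} (x y : V n) → ⟨ x , y ⟩ ≡ ⟨ y , x ⟩
⟨⟩-comm []      []      = refl
⟨⟩-comm (a ∷ x) (b ∷ y) = cong₂ _xor_ (∧-comm a b) (⟨⟩-comm x y)

⟨⟩-zeroʳ : ∀ {n} (x : V n) → ⟨ x , 𝟘 ⟩ ≡ false
⟨⟩-zeroʳ []          = refl
⟨⟩-zeroʳ (false ∷ x) = ⟨⟩-zeroʳ x
⟨⟩-zeroʳ (true ∷ x)  = ⟨⟩-zeroʳ x

⟨⟩-distribʳ : ∀ {n} (x y z : V n) → ⟨ x , y +V z ⟩ ≡ ⟨ x , y ⟩ xor ⟨ x , z ⟩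
⟨⟩-distribʳ []      []      []      = refl
⟨⟩-distribʳ (a ∷ x) (b ∷ y) (c ∷ z) = begin
  (a ∧ (b xor c)) xor ⟨ x , y +V z ⟩                  ≡⟨ cong₂ _xor_ (∧-distribˡ-xor a b c) (⟨⟩-distribʳ x y z) ⟩
  ((a ∧ b) xor (a ∧ c)) xor (⟨ x , y ⟩ xor ⟨ x , z ⟩) ≡⟨ xor-interchange (a ∧ b) (a ∧ c) _ _ ⟩
  ((a ∧ b) xor ⟨ x , y ⟩) xor ((a ∧ c) xor ⟨ x , z ⟩) ∎
  where open ≡-Reasoning

⟨⟩-distribˡ : ∀ {n} (x y z : V n) → ⟨ x +V y , z ⟩ ≡ ⟨ x , z ⟩ xor ⟨ y , z ⟩
⟨⟩-distribˡ x y z = begin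
  ⟨ x +V y , z ⟩          ≡⟨ ⟨⟩-comm (x +V y) z ⟩
  ⟨ z , x +V y ⟩          ≡⟨ ⟨⟩-distribʳ z x y ⟩
  ⟨ z , x ⟩ xor ⟨ z , y ⟩ ≡⟨ cong₂ _xor_ (⟨⟩-comm z x) (⟨⟩-comm z y) ⟩
  ⟨ x , z ⟩ xor ⟨ y , z ⟩ ∎
  where open ≡-Reasoning

⟨⟩-nondegenerate : ∀ {n} (a : V n) → a ≢ 𝟘 → ∃[ u ] ⟨ a , u ⟩ ≡ true
⟨⟩-nondegenerate []          a≢𝟘 = contradiction refl a≢𝟘
⟨⟩-nondegenerate (true ∷ a)  _   = true ∷ 𝟘 , cong (true xor_) (⟨⟩-zeroʳ a)
⟨⟩-nondegenerate (false ∷ a) a≢𝟘 with u , ⟨a,u⟩≡1 ← ⟨⟩-nondegenerate a (a≢𝟘 ∘ cong (false ∷_)) =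
  false ∷ u , ⟨a,u⟩≡1

𝟘∈span : ∀ {n} (T : List (V n)) → 𝟘 ∈ spanList T
𝟘∈span []      = here refl
𝟘∈span (t ∷ T) = ∈-++⁺ˡ (𝟘∈span T)

∈span-∷ : ∀ {n} {x : V n} t T → x ∈ spanList T → x ∈ spanList (t ∷ T)
∈span-∷ t T = ∈-++⁺ˡ

+∈span-∷ : ∀ {n} {y : V n} t T → y ∈ spanList T → t +V y ∈ spanList (t ∷ T)
+∈span-∷ t T y∈ = ∈-++⁺ʳ (spanList T) (∈-map⁺ (t +V_) y∈)

∈span-∷⁻ : ∀ {n} {x : V n} t T → x ∈ spanList (t ∷ T) → x ∈ spanList T ⊎ x +V t ∈ spanList T
∈span-∷⁻ t T x∈ with ∈-++⁻ (spanList T) x∈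
... | inj₁ x∈T = inj₁ x∈T
... | inj₂ x∈t+T with y , y∈T , refl ← ∈-map⁻ (t +V_) x∈t+T =
  inj₂ (subst (_∈ spanList T) (sym (trans (cong (_+V t) (+V-comm t y)) (+V-cancelʳ y t))) y∈T)

∈span[]⁻ : ∀ {n} {x : V n} → x ∈ spanList [] → x ≡ 𝟘
∈span[]⁻ (here x≡𝟘) = x≡𝟘

span-+ : ∀ {n} (T : List (V n)) {x y} → x ∈ spanList T → y ∈ spanList T → x +V y ∈ spanList T
span-+ [] x∈ y∈ rewrite ∈span[]⁻ x∈ | ∈span[]⁻ y∈ = subst (_∈ spanList []) (sym (+V-self 𝟘)) (here refl)
span-+ (t ∷ T) {x} {y} x∈ y∈ with ∈span-∷⁻ t T x∈ | ∈span-∷⁻ t T y∈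
... | inj₁ x∈T   | inj₁ y∈T   = ∈span-∷ t T (span-+ T x∈T y∈T)
... | inj₁ x∈T   | inj₂ y+t∈T = subst (_∈ spanList (t ∷ T)) eq (+∈span-∷ t T (span-+ T x∈T y+t∈T))
  where eq : t +V (x +V (y +V t)) ≡ x +V y
        eq = trans (+V-comm t _) (trans (+V-assoc x _ t) (cong (x +V_) (+V-cancelʳ y t)))
... | inj₂ x+t∈T | inj₁ y∈T   = subst (_∈ spanList (t ∷ T)) eq (+∈span-∷ t T (span-+ T x+t∈T y∈T))
  where eq : t +V ((x +V t) +V y) ≡ x +V y
        eq = trans (sym (+V-assoc t (x +V t) y))
                   (cong (_+V y) (trans (+V-comm t (x +V t)) (+V-cancelʳ x t)))
... | inj₂ x+t∈T | inj₂ y+t∈T = ∈span-∷ t T (subst (_∈ spanList T) eq (span-+ T x+t∈T y+t∈T))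
  where eq : (x +V t) +V (y +V t) ≡ x +V y
        eq = trans (+V-interchange x t y t) (trans (cong ((x +V y) +V_) (+V-self t)) (+V-identityʳ _))

∈span-∷⁺ : ∀ {n} {x : V n} t T → x +V t ∈ spanList T → x ∈ spanList (t ∷ T)
∈span-∷⁺ {x = x} t T x+t∈ =
  subst (_∈ spanList (t ∷ T)) (trans (+V-comm t _) (+V-cancelʳ x t)) (+∈span-∷ t T x+t∈)

∈⇒∈span : ∀ {n} {T : List (V n)} {t} → t ∈ T → t ∈ spanList T
∈⇒∈span {T = t ∷ T} (here refl) = subst (_∈ spanList (t ∷ T)) (+V-identityʳ t) (+∈span-∷ t T (𝟘∈span T))
∈⇒∈span {T = t ∷ T} (there t∈T) = ∈span-∷ t T (∈⇒∈span t∈T)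

span-⊆ : ∀ {n} (T T' : List (V n)) → T ⊆ spanList T' → spanList T ⊆ spanList T'
span-⊆ []      T' _  x∈ rewrite ∈span[]⁻ x∈ = 𝟘∈span T'
span-⊆ (t ∷ T) T' T⊆ {x} x∈ with ∈span-∷⁻ t T x∈
... | inj₁ x∈T   = span-⊆ T T' (T⊆ ∘ there) x∈T
... | inj₂ x+t∈T =
  subst (_∈ spanList T') (+V-cancelʳ x t) (span-+ T' (span-⊆ T T' (T⊆ ∘ there) x+t∈T) (T⊆ (here refl)))

⊥-+ : ∀ {n} {u₁ u₂ : V n} {T} → All (λ t → ⟨ t , u₁ ⟩ ≡ false) T → All (λ t → ⟨ t , u₂ ⟩ ≡ false) T →
  All (λ t → ⟨ t , u₁ +V u₂ ⟩ ≡ false) T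
⊥-+ {u₁ = u₁} {u₂} T⊥u₁ T⊥u₂ =
  All.zipWith (λ {t} (p , q) → trans (⟨⟩-distribʳ t u₁ u₂) (cong₂ _xor_ p q)) (T⊥u₁ , T⊥u₂)

xor≡true⇒≡not : ∀ x y → x xor y ≡ true → x ≡ not y
xor≡true⇒≡not x false eq = trans (sym (xor-identityʳ x)) eq
xor≡true⇒≡not false true _  = refl
xor≡true⇒≡not true  true ()

-- From functionals u₁ for a and u₂ for a + t over T, one of u₁, u₂, u₁ + u₂ also vanishes on t.
∉span⇒separating : ∀ {n} (T : List (V n)) a → a ∉ spanList T →
  ∃[ u ] (⟨ a , u ⟩ ≡ true × All (λ t → ⟨ t , u ⟩ ≡ false) T)
∉span⇒separating [] a a∉ with u , ⟨a,u⟩≡1 ← ⟨⟩-nondegenerate a (a∉ ∘ here) = u , ⟨a,u⟩≡1 , []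
∉span⇒separating (t ∷ T) a a∉
  with u₁ , ⟨a,u₁⟩≡1 , T⊥u₁ ← ∉span⇒separating T a (a∉ ∘ ∈span-∷ t T)
     | u₂ , ⟨a+t,u₂⟩≡1 , T⊥u₂ ← ∉span⇒separating T (a +V t) (a∉ ∘ ∈span-∷⁺ t T)
  with ⟨ t , u₁ ⟩ in ⟨t,u₁⟩ | ⟨ t , u₂ ⟩ in ⟨t,u₂⟩
     | xor≡true⇒≡not ⟨ a , u₂ ⟩ ⟨ t , u₂ ⟩ (trans (sym (⟨⟩-distribˡ a t u₂)) ⟨a+t,u₂⟩≡1)
... | false | _     | _        = u₁ , ⟨a,u₁⟩≡1 , ⟨t,u₁⟩ ∷ T⊥u₁
... | true  | false | ⟨a,u₂⟩≡1 = u₂ , ⟨a,u₂⟩≡1 , ⟨t,u₂⟩ ∷ T⊥u₂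
... | true  | true  | ⟨a,u₂⟩≡0 =
  u₁ +V u₂ , trans (⟨⟩-distribʳ a u₁ u₂) (cong₂ _xor_ ⟨a,u₁⟩≡1 ⟨a,u₂⟩≡0)
           , trans (⟨⟩-distribʳ t u₁ u₂) (cong₂ _xor_ ⟨t,u₁⟩ ⟨t,u₂⟩) ∷ ⊥-+ T⊥u₁ T⊥u₂

count : ∀ n → (V n → Bool) → ℕ
count zero    f = if f [] then 1 else 0
count (suc n) f = count n (f ∘ (false ∷_)) + count n (f ∘ (true ∷_))

filter-map : ∀ {A B : Set} (f : B → Bool) (g : A → B) xs →
  filter (λ y → f y ≟ᵇ true) (map g xs) ≡ map g (filter (λ x → f (g x) ≟ᵇ true) xs)
filter-map f g []       = refl
filter-map f g (x ∷ xs) with f (g x)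
... | true  = cong (g x ∷_) (filter-map f g xs)
... | false = filter-map f g xs

length-filter-allV : ∀ n (f : V n → Bool) → length (filter (λ w → f w ≟ᵇ true) (allV n)) ≡ count n f
length-filter-allV zero f with f []
... | true  = refl
... | false = refl
length-filter-allV (suc n) f = begin
  length (filter P? (map (false ∷_) (allV n) ++ map (true ∷_) (allV n)))
    ≡⟨ cong length (filter-++ P? (map (false ∷_) (allV n)) _) ⟩
  length (filter P? (map (false ∷_) (allV n)) ++ filter P? (map (true ∷_) (allV n)))
    ≡⟨ length-++ (filter P? (map (false ∷_) (allV n))) ⟩
  length (filter P? (map (false ∷_) (allV n))) + length (filter P? (map (true ∷_) (allV n)))
    ≡⟨ cong₂ _+_ (half false) (half true) ⟩
  count n (f ∘ (false ∷_)) + count n (f ∘ (true ∷_)) ∎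
  where
    open ≡-Reasoning
    P? = λ w → f w ≟ᵇ true
    half : ∀ b → length (filter P? (map (b ∷_) (allV n))) ≡ count n (f ∘ (b ∷_))
    half b = trans (cong length (filter-map f (b ∷_) (allV n)))
                   (trans (length-map (b ∷_) (filter (λ w → f (b ∷ w) ≟ᵇ true) (allV n)))
                          (length-filter-allV n (f ∘ (b ∷_))))

countDisj≡count : ∀ {n} (S : List (V n)) → countDisj S ≡ count n (disjointA S)
countDisj≡count {n} S = length-filter-allV n (disjointA S)

count-cong : ∀ n {f g : V n → Bool} → (∀ w → f w ≡ g w) → count n f ≡ count n g
count-cong zero    f≗g rewrite f≗g [] = refl
count-cong (suc n) f≗g = cong₂ _+_ (count-cong n (f≗g ∘ (false ∷_))) (count-cong n (f≗g ∘ (true ∷_)))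

count-translate : ∀ n (f : V n → Bool) (u : V n) → count n (λ w → f (w +V u)) ≡ count n f
count-translate zero    f []          = refl
count-translate (suc n) f (false ∷ u) =
  cong₂ _+_ (count-translate n (f ∘ (false ∷_)) u) (count-translate n (f ∘ (true ∷_)) u)
count-translate (suc n) f (true ∷ u)  =
  trans (cong₂ _+_ (count-translate n (f ∘ (true ∷_)) u) (count-translate n (f ∘ (false ∷_)) u))
        (+-comm (count n (f ∘ (true ∷_))) (count n (f ∘ (false ∷_))))

count-split : ∀ n (p f : V n → Bool) →
  count n f ≡ count n (λ w → p w ∧ f w) + count n (λ w → not (p w) ∧ f w)
count-split zero p f with p [] | f []
... | true  | true  = refl
... | true  | false = refl
... | false | true  = refl
... | false | false = refl
count-split (suc n) p f = begin
  count n f₀ + count n f₁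
    ≡⟨ cong₂ _+_ (count-split n p₀ f₀) (count-split n p₁ f₁) ⟩
  (count n (p₀ ∧̇ f₀) + count n (¬p₀ ∧̇ f₀)) + (count n (p₁ ∧̇ f₁) + count n (¬p₁ ∧̇ f₁))
    ≡⟨ +-interchange (count n (p₀ ∧̇ f₀)) (count n (¬p₀ ∧̇ f₀)) (count n (p₁ ∧̇ f₁)) (count n (¬p₁ ∧̇ f₁)) ⟩
  (count n (p₀ ∧̇ f₀) + count n (p₁ ∧̇ f₁)) + (count n (¬p₀ ∧̇ f₀) + count n (¬p₁ ∧̇ f₁)) ∎
  where
    open ≡-Reasoning
    _∧̇_ : (V n → Bool) → (V n → Bool) → V n → Bool
    (q ∧̇ g) w = q w ∧ g w
    p₀ = p ∘ (false ∷_)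
    p₁ = p ∘ (true ∷_)
    ¬p₀ = not ∘ p₀
    ¬p₁ = not ∘ p₁
    f₀ = f ∘ (false ∷_)
    f₁ = f ∘ (true ∷_)

count-mono : ∀ n {f g : V n → Bool} → (∀ w → f w ≡ true → g w ≡ true) → count n f ℕ.≤ count n g
count-mono zero {f} {g} f⇒g with f [] | g [] | f⇒g []
... | false | _     | _   = z≤n
... | true  | true  | _   = ≤-refl
... | true  | false | f⇒g[] with () ← f⇒g[] refl
count-mono (suc n) f⇒g = ℕP.+-mono-≤ (count-mono n (f⇒g ∘ (false ∷_))) (count-mono n (f⇒g ∘ (true ∷_)))

count-true : ∀ n → count n (λ _ → true) ≡ 2 ^ n
count-true zero    = refl
count-true (suc n) =
  trans (cong₂ _+_ (count-true n) (count-true n)) (cong (_+_ (2 ^ n)) (sym (ℕP.+-identityʳ (2 ^ n))))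

count-halves : ∀ n (g : V n → Bool) (a u : V n) → ⟨ a , u ⟩ ≡ true → (∀ w → g (w +V u) ≡ g w) →
  count n (λ w → not ⟨ a , w ⟩ ∧ g w) * 2 ≡ count n g
count-halves n g a u ⟨a,u⟩≡1 g-inv = begin
  c * 2                                  ≡⟨ ℕP.*-comm c 2 ⟩
  c + (c + 0)                            ≡⟨ cong (_+_ c) (ℕP.+-identityʳ c) ⟩
  c + c                                  ≡⟨ cong (_+ c) swap ⟨
  count n (λ w → ⟨ a , w ⟩ ∧ g w) + c    ≡⟨ count-split n (λ w → ⟨ a , w ⟩) g ⟨
  count n g                              ∎
  where
    open ≡-Reasoning
    c = count n (λ w → not ⟨ a , w ⟩ ∧ g w)
    flip : ∀ w → not ⟨ a , w +V u ⟩ ∧ g (w +V u) ≡ ⟨ a , w ⟩ ∧ g w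
    flip w rewrite ⟨⟩-distribʳ a w u | ⟨a,u⟩≡1 | g-inv w =
      cong (_∧ g w) (trans (cong not (trans (xor-comm ⟨ a , w ⟩ true) (true-xor _))) (not-involutive _))
    swap : count n (λ w → ⟨ a , w ⟩ ∧ g w) ≡ c
    swap = trans (sym (count-cong n flip)) (count-translate n (λ w → not ⟨ a , w ⟩ ∧ g w) u)

disjointA-translate : ∀ {n} (T : List (V n)) {u} → All (λ t → ⟨ t , u ⟩ ≡ false) T →
  ∀ w → disjointA T (w +V u) ≡ disjointA T w
disjointA-translate []      []               w = refl
disjointA-translate (t ∷ T) {u} (⟨t,u⟩ ∷ T⊥u) w =
  cong₂ (λ b d → not b ∧ d) ⟨t,w+u⟩ (disjointA-translate T T⊥u w)
  where ⟨t,w+u⟩ = trans (⟨⟩-distribʳ t w u) (trans (cong (⟨ t , w ⟩ xor_) ⟨t,u⟩) (xor-identityʳ _))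

disjointA⇒⊥ : ∀ {n} (S : List (V n)) w → disjointA S w ≡ true → ∀ {v} → v ∈ S → ⟨ v , w ⟩ ≡ false
disjointA⇒⊥ (s ∷ S) w disj v∈ with ⟨ s , w ⟩ in ⟨s,w⟩ | v∈
... | false | here refl = ⟨s,w⟩
... | false | there v∈S = disjointA⇒⊥ S w disj v∈S

⊥⇒disjointA : ∀ {n} (T : List (V n)) w → (∀ {v} → v ∈ T → ⟨ v , w ⟩ ≡ false) → disjointA T w ≡ true
⊥⇒disjointA []      w _   = refl
⊥⇒disjointA (t ∷ T) w T⊥w rewrite T⊥w (here refl) = ⊥⇒disjointA T w (T⊥w ∘ there)

count-disjointA-antitone : ∀ {n} {S T : List (V n)} → T ⊆ S → count n (disjointA S) ℕ.≤ count n (disjointA T)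
count-disjointA-antitone {S = S} {T} T⊆S =
  count-mono _ λ w disj → ⊥⇒disjointA T w (disjointA⇒⊥ S w disj ∘ T⊆S)

data Independent {n} : List (V n) → Set where
  []  : Independent []
  _∷_ : ∀ {a T} → a ∉ spanList T → Independent T → Independent (a ∷ T)

count-disjointA-∷ : ∀ {n} (T : List (V n)) a → a ∉ spanList T →
  count n (disjointA (a ∷ T)) * 2 ≡ count n (disjointA T)
count-disjointA-∷ {n} T a a∉ with u , ⟨a,u⟩≡1 , T⊥u ← ∉span⇒separating T a a∉ =
  count-halves n (disjointA T) a u ⟨a,u⟩≡1 (disjointA-translate T T⊥u)

count-disjointA-independent : ∀ {n} {T : List (V n)} → Independent T →
  count n (disjointA T) * 2 ^ length T ≡ 2 ^ n
count-disjointA-independent {n} [] = trans (ℕP.*-identityʳ _) (count-true n)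
count-disjointA-independent {n} {a ∷ T} (a∉ ∷ indT) = begin
  count n (disjointA (a ∷ T)) * (2 * 2 ^ length T) ≡⟨ *-assoc (count n (disjointA (a ∷ T))) 2 _ ⟨
  count n (disjointA (a ∷ T)) * 2 * 2 ^ length T   ≡⟨ cong (_* 2 ^ length T) (count-disjointA-∷ T a a∉) ⟩
  count n (disjointA T) * 2 ^ length T             ≡⟨ count-disjointA-independent indT ⟩
  2 ^ n                                            ∎
  where open ≡-Reasoning

+c/d≡+c′/d′ : ∀ c d c′ d′ .{{_ : ℕ.NonZero d}} .{{_ : ℕ.NonZero d′}} →
  c * d′ ≡ c′ * d → (+ c) / d ≡ (+ c′) / d′
+c/d≡+c′/d′ c (suc d) c′ (suc d′) eq = toℚᵘ-injective (ℚᵘP.≃-trans (toℚᵘ-fromℚᵘ (mkℚᵘ (+ c) d))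
  (ℚᵘP.≃-trans (*≡* (trans (sym (ℤP.pos-* c (suc d′))) (trans (cong +_ eq) (ℤP.pos-* c′ (suc d)))))
               (ℚᵘP.≃-sym (toℚᵘ-fromℚᵘ (mkℚᵘ (+ c′) d′)))))

+c/d≤+c′/d′ : ∀ c d c′ d′ .{{_ : ℕ.NonZero d}} .{{_ : ℕ.NonZero d′}} →
  c * d′ ℕ.≤ c′ * d → (+ c) / d ≤ (+ c′) / d′
+c/d≤+c′/d′ c (suc d) c′ (suc d′) le = toℚᵘ-cancel-≤
  (ℚᵘP.≤-respˡ-≃ (ℚᵘP.≃-sym (toℚᵘ-fromℚᵘ (mkℚᵘ (+ c) d)))
  (ℚᵘP.≤-respʳ-≃ (ℚᵘP.≃-sym (toℚᵘ-fromℚᵘ (mkℚᵘ (+ c′) d′)))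
  (*≤* (subst₂ ℤ._≤_ (ℤP.pos-* c (suc d′)) (ℤP.pos-* c′ (suc d)) (ℤ.+≤+ le)))))

q0-≤-independent : ∀ {n} {S T : List (V n)} k → Independent T → T ⊆ S → suc k ℕ.≤ 2 ^ length T →
  q0 S ≤ + 1 / suc k
q0-≤-independent {n} {S} {T} k indT T⊆S k<2^|T| rewrite countDisj≡count S =
  +c/d≤+c′/d′ (count n (disjointA S)) (2 ^ n) 1 (suc k) {{ℕP.m^n≢0 2 n}} (begin
    count n (disjointA S) * suc k           ≤⟨ ℕP.*-mono-≤ (count-disjointA-antitone T⊆S) k<2^|T| ⟩
    count n (disjointA T) * 2 ^ length T    ≡⟨ count-disjointA-independent indT ⟩
    2 ^ n                                   ≡⟨ ℕP.*-identityˡ (2 ^ n) ⟨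
    1 * 2 ^ n                               ∎)
  where open ℕP.≤-Reasoning

q0-[] : ∀ n → q0 {n} [] ≡ 1ℚ
q0-[] n rewrite countDisj≡count {n} [] | count-true n =
  +c/d≡+c′/d′ (2 ^ n) (2 ^ n) 1 1 {{ℕP.m^n≢0 2 n}} (ℕP.*-comm (2 ^ n) 1)

≢𝟘⇒∉span[] : ∀ {n} {x : V n} → x ≢ 𝟘 → x ∉ spanList []
≢𝟘⇒∉span[] x≢𝟘 (here x≡𝟘) = x≢𝟘 x≡𝟘

q0-[x] : ∀ {n} (x : V n) → x ≢ 𝟘 → q0 (x ∷ []) ≡ ½
q0-[x] {n} x x≢𝟘 rewrite countDisj≡count (x ∷ []) =
  +c/d≡+c′/d′ (count n (disjointA (x ∷ []))) (2 ^ n) 1 2 {{ℕP.m^n≢0 2 n}}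
    (trans (count-disjointA-independent (≢𝟘⇒∉span[] x≢𝟘 ∷ [])) (sym (ℕP.*-identityˡ (2 ^ n))))

independent-pair : ∀ {n} {x y : V n} → x ≢ y → x ≢ 𝟘 → y ≢ 𝟘 → Independent (x ∷ y ∷ [])
independent-pair {y = y} x≢y x≢𝟘 y≢𝟘 = x∉span[y] ∷ ≢𝟘⇒∉span[] y≢𝟘 ∷ []
  where
    x∉span[y] : _ ∉ spanList (y ∷ [])
    x∉span[y] (here x≡𝟘)         = x≢𝟘 x≡𝟘
    x∉span[y] (there (here x≡y)) = x≢y (trans x≡y (+V-identityʳ y))

q0-≤¼ : ∀ {n} (S : List (V n)) {x y} → x ∈ S → y ∈ S → x ≢ y → x ≢ 𝟘 → y ≢ 𝟘 → q0 S ≤ + 1 / 4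
q0-≤¼ S x∈S y∈S x≢y x≢𝟘 y≢𝟘 = q0-≤-independent 3 (independent-pair x≢y x≢𝟘 y≢𝟘) [x,y]⊆S ≤-refl
  where
    [x,y]⊆S : _ ⊆ S
    [x,y]⊆S (here refl)         = x∈S
    [x,y]⊆S (there (here refl)) = y∈S

q0-≤¼-of-length≥2 : ∀ {n} (S : List (V n)) → Unique S → All (_≢ 𝟘) S → 2 ℕ.≤ length S → q0 S ≤ + 1 / 4
q0-≤¼-of-length≥2 (x ∷ y ∷ S) ((x≢y ∷ _) ∷ _) (x≢𝟘 ∷ y≢𝟘 ∷ _) _ =
  q0-≤¼ (x ∷ y ∷ S) (here refl) (there (here refl)) x≢y x≢𝟘 y≢𝟘
q0-≤¼-of-length≥2 (_ ∷ []) _ _ (s≤s ())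

module _ {n : ℕ} where

  open import Data.List.Membership.DecPropositional (_≟V_ {n}) using (_∈?_)

  ∈-remove⁻ : ∀ {v w : V n} {S} → w ∈ remove v S → w ∈ S × w ≢ v
  ∈-remove⁻ {v} {S = S} = ∈-filter⁻ (λ u → ¬? (u ≟V v)) {xs = S}

  ∈-remove⁺ : ∀ {v w : V n} {S} → w ∈ S → w ≢ v → w ∈ remove v S
  ∈-remove⁺ {v} = ∈-filter⁺ (λ u → ¬? (u ≟V v))

  remove-∷-∉ : ∀ {v : V n} {S} → v ∉ S → remove v (v ∷ S) ≡ S
  remove-∷-∉ {v} {S} v∉S =
    trans (filter-reject (λ u → ¬? (u ≟V v)) (λ v≢v → v≢v refl))
          (filter-all (λ u → ¬? (u ≟V v)) (All.tabulate λ u∈S u≡v → v∉S (subst (_∈ S) u≡v u∈S)))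

  ∈J⁻ : ∀ {v : V n} {S} → v ∈ J S → v ∈ S × v ∈ spanList (remove v S)
  ∈J⁻ {S = S} = ∈-filter⁻ (λ v → v ∈? spanList (remove v S)) {xs = S}

  ∈J⁺ : ∀ {v : V n} {S} → v ∈ S → v ∈ spanList (remove v S) → v ∈ J S
  ∈J⁺ {S = S} = ∈-filter⁺ (λ v → v ∈? spanList (remove v S))

  exchange : ∀ (R : List (V n)) → Unique R → ∀ {x} → x ∈ spanList R → x ≢ 𝟘 →
    ∃[ u ] (u ∈ R × u +V x ∈ spanList (remove u R))
  exchange []      _              x∈ x≢𝟘 = contradiction (∈span[]⁻ x∈) x≢𝟘
  exchange (r ∷ R) (r∉R ∷ uniqR) {x} x∈ x≢𝟘 with ∈span-∷⁻ r R x∈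
  ... | inj₁ x∈R with u , u∈R , u+x∈ ← exchange R uniqR x∈R x≢𝟘 =
    u , there u∈R , span-⊆ (remove u R) (remove u (r ∷ R)) (∈⇒∈span ∘ remove-mono) u+x∈
    where
      remove-mono : remove u R ⊆ remove u (r ∷ R)
      remove-mono w∈ with w∈R , w≢u ← ∈-remove⁻ {S = R} w∈ = ∈-remove⁺ {S = r ∷ R} (there w∈R) w≢u
  ... | inj₂ x+r∈R =
    r , here refl , subst₂ (λ y T → y ∈ spanList T) (+V-comm x r) (sym (remove-∷-∉ r∉R′)) x+r∈R
    where r∉R′ = λ r∈R → All.lookup r∉R r∈R refl

  J-second : ∀ {S : List (V n)} → Unique S → All (_≢ 𝟘) S → ∀ {v} → v ∈ J S → ∃[ u ] (u ∈ J S × u ≢ v)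
  J-second {S} uniqS S≢𝟘 {v} v∈J
    with v∈S , v∈span ← ∈J⁻ v∈J
    with u , u∈R , u+v∈ ← exchange (remove v S) (UniqP.filter⁺ _ uniqS) v∈span (All.lookup S≢𝟘 v∈S)
    with u∈S , u≢v ← ∈-remove⁻ {S = S} u∈R = u , ∈J⁺ u∈S u∈span , u≢v
    where
      remove-v-⊆ : remove u (remove v S) ⊆ spanList (remove u S)
      remove-v-⊆ w∈ with w∈R , w≢u ← ∈-remove⁻ {S = remove v S} w∈ =
        ∈⇒∈span (∈-remove⁺ {S = S} (proj₁ (∈-remove⁻ {S = S} w∈R)) w≢u)
      u∈span : u ∈ spanList (remove u S)
      u∈span = subst (_∈ spanList (remove u S)) (+V-cancelʳ u v)
        (span-+ (remove u S) (span-⊆ (remove u (remove v S)) (remove u S) remove-v-⊆ u+v∈)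
                             (∈⇒∈span (∈-remove⁺ {S = S} v∈S (u≢v ∘ sym))))

  m≡0⇒∈span-remove : ∀ {S : List (V n)} → m S ≡ 0 → ∀ {v} → v ∈ S → v ∈ spanList (remove v S)
  m≡0⇒∈span-remove {S} m≡0 {v} v∈S with v ∈? spanList (remove v S)
  ... | yes v∈span = v∈span
  ... | no  v∉span = contradiction (subst (0 ℕ.<_) m≡0 (∈-length v∈I)) λ ()
    where v∈I = ∈-filter⁺ (λ w → ¬? (w ∈? spanList (remove w S))) v∈S v∉span

basis : ∀ {n} (S : List (V n)) → ∃[ B ] (Independent B × B ⊆ S × S ⊆ spanList B)
basis [] = [] , [] , (λ ()) , (λ ())
basis {n} (s ∷ S) with B , indB , B⊆S , S⊆spanB ← basis S | s ∈? spanList B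
  where open import Data.List.Membership.DecPropositional (_≟V_ {n}) using (_∈?_)
... | yes s∈spanB = B , indB , there ∘ B⊆S , λ { (here refl) → s∈spanB ; (there v∈S) → S⊆spanB v∈S }
... | no  s∉spanB = s ∷ B , s∉spanB ∷ indB , (λ { (here refl) → here refl ; (there v∈B) → there (B⊆S v∈B) })
                  , λ { (here refl) → ∈⇒∈span {T = s ∷ B} (here refl) ; (there v∈S) → ∈span-∷ s B (S⊆spanB v∈S) }

shape₃ : ∀ {n} → V n → V n → List (V n)
shape₃ x y = x ∷ y ∷ (x +V y) ∷ []

shape₅ : ∀ {n} → V n → V n → V n → List (V n)
shape₅ x y z = x ∷ y ∷ z ∷ (x +V y) ∷ (x +V z) ∷ []

shape₇ : ∀ {n} → V n → V n → V n → List (V n)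
shape₇ x y z = x ∷ y ∷ z ∷ (x +V y) ∷ (y +V z) ∷ (x +V z) ∷ (x +V y +V z) ∷ []

Form₃ Form₅ Form₇ : ∀ {n} → List (V n) → Set
Form₃ S = ∃[ x ] ∃[ y ] (S ↭ shape₃ x y)
Form₅ S = ∃[ x ] ∃[ y ] ∃[ z ] (S ↭ shape₅ x y z)
Form₇ S = ∃[ x ] ∃[ y ] ∃[ z ] (S ↭ shape₇ x y z)

m[s]≢0 : ∀ {n} (s : V n) → s ≢ 𝟘 → m (s ∷ []) ≢ 0
m[s]≢0 s s≢𝟘 m≡0 =
  s≢𝟘 (∈span[]⁻ (subst (λ T → s ∈ spanList T) (remove-∷-∉ {v = s} {S = []} λ ())
                        (m≡0⇒∈span-remove m≡0 (here refl))))

m≡0⇒Form₃ : ∀ {n} {s₁ s₂ s₃ : V n} → Unique (s₁ ∷ s₂ ∷ s₃ ∷ []) → s₁ ≢ 𝟘 → m (s₁ ∷ s₂ ∷ s₃ ∷ []) ≡ 0 →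
  Form₃ (s₁ ∷ s₂ ∷ s₃ ∷ [])
m≡0⇒Form₃ {s₁ = s₁} {s₂} {s₃} ((s₁≢s₂ ∷ s₁≢s₃ ∷ []) ∷ _) s₁≢𝟘 m≡0 =
  s₂ , s₃ , subst (λ s → s₁ ∷ s₂ ∷ s₃ ∷ [] ↭ s₂ ∷ s₃ ∷ s ∷ []) s₁≡s₂+s₃ rotate
  where
    s₁∉[s₂,s₃] : s₁ ∉ s₂ ∷ s₃ ∷ []
    s₁∉[s₂,s₃] (here s₁≡s₂)         = s₁≢s₂ s₁≡s₂
    s₁∉[s₂,s₃] (there (here s₁≡s₃)) = s₁≢s₃ s₁≡s₃
    s₁∈span : s₁ ∈ spanList (s₂ ∷ s₃ ∷ [])
    s₁∈span = subst (λ T → s₁ ∈ spanList T) (remove-∷-∉ {S = s₂ ∷ s₃ ∷ []} s₁∉[s₂,s₃])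
                    (m≡0⇒∈span-remove m≡0 (here refl))
    s₁≡s₂+s₃ : s₁ ≡ s₂ +V s₃
    s₁≡s₂+s₃ with s₁∈span
    ... | here s₁≡𝟘                         = contradiction s₁≡𝟘 s₁≢𝟘
    ... | there (here s₁≡s₃+𝟘)              = contradiction (trans s₁≡s₃+𝟘 (+V-identityʳ s₃)) s₁≢s₃
    ... | there (there (here s₁≡s₂+𝟘))      = contradiction (trans s₁≡s₂+𝟘 (+V-identityʳ s₂)) s₁≢s₂
    ... | there (there (there (here s₁≡s))) = trans s₁≡s (cong (s₂ +V_) (+V-identityʳ s₃))
    rotate : s₁ ∷ s₂ ∷ s₃ ∷ [] ↭ s₂ ∷ s₃ ∷ s₁ ∷ []
    rotate = ↭-trans (_↭_.swap _ _ _↭_.refl) (prep s₂ (_↭_.swap _ _ _↭_.refl))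

_·_ : ∀ {n} → Bool → V n → V n
false · v = 𝟘
true  · v = v

·-distrib-xor : ∀ {n} b c (v : V n) → (b xor c) · v ≡ b · v +V c · v
·-distrib-xor false false v = sym (+V-self 𝟘)
·-distrib-xor false true  v = sym (+V-identityˡ v)
·-distrib-xor true  false v = sym (+V-identityʳ v)
·-distrib-xor true  true  v = sym (+V-self v)

lincomb : ∀ {k n} → V k → Vec (V n) k → V n
lincomb []      []      = 𝟘
lincomb (b ∷ t) (g ∷ G) = b · g +V lincomb t G

lincomb-𝟘 : ∀ {k n} (G : Vec (V n) k) → lincomb 𝟘 G ≡ 𝟘
lincomb-𝟘 []      = refl
lincomb-𝟘 (g ∷ G) = trans (+V-identityˡ _) (lincomb-𝟘 G)

lincomb-+ : ∀ {k n} (s t : V k) (G : Vec (V n) k) → lincomb (s +V t) G ≡ lincomb s G +V lincomb t G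
lincomb-+ []      []      []      = sym (+V-self 𝟘)
lincomb-+ (b ∷ s) (c ∷ t) (g ∷ G) = begin
  (b xor c) · g +V lincomb (s +V t) G                 ≡⟨ cong₂ _+V_ (·-distrib-xor b c g) (lincomb-+ s t G) ⟩
  (b · g +V c · g) +V (lincomb s G +V lincomb t G)    ≡⟨ +V-interchange (b · g) (c · g) _ _ ⟩
  (b · g +V lincomb s G) +V (c · g +V lincomb t G)    ∎
  where open ≡-Reasoning

∈span⇒lincomb : ∀ {k n} (G : Vec (V n) k) {x} → x ∈ spanList (toList G) → ∃[ t ] lincomb t G ≡ x
∈span⇒lincomb []      x∈ = [] , sym (∈span[]⁻ x∈)
∈span⇒lincomb (g ∷ G) {x} x∈ with ∈span-∷⁻ g (toList G) x∈
... | inj₁ x∈G   with t , Gt≡x ← ∈span⇒lincomb G x∈G     = false ∷ t , trans (+V-identityˡ _) Gt≡x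
... | inj₂ x+g∈G with t , Gt≡x+g ← ∈span⇒lincomb G x+g∈G =
  true ∷ t , trans (cong (g +V_) Gt≡x+g) (trans (+V-comm g _) (+V-cancelʳ x g))

Additive : ∀ {k n} → (V k → V n) → Set
Additive L = ∀ s t → L (s +V t) ≡ L s +V L t

map-shape₅ : ∀ {k n} (L : V k → V n) → Additive L →
  ∀ x y z → map L (shape₅ x y z) ≡ shape₅ (L x) (L y) (L z)
map-shape₅ L L-+ x y z rewrite L-+ x y | L-+ x z = refl

map-shape₇ : ∀ {k n} (L : V k → V n) → Additive L →
  ∀ x y z → map L (shape₇ x y z) ≡ shape₇ (L x) (L y) (L z)
map-shape₇ L L-+ x y z rewrite L-+ (x +V y) z | L-+ x y | L-+ y z | L-+ x z = refl

map⁺-Form₅ : ∀ {k n} (L : V k → V n) → Additive L → ∀ {S} → Form₅ S → Form₅ (map L S)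
map⁺-Form₅ L L-+ {S} (x , y , z , S↭) =
  L x , L y , L z , subst (map L S ↭_) (map-shape₅ L L-+ x y z) (↭-map⁺ L S↭)

map⁺-Form₇ : ∀ {k n} (L : V k → V n) → Additive L → ∀ {S} → Form₇ S → Form₇ (map L S)
map⁺-Form₇ L L-+ {S} (x , y , z , S↭) =
  L x , L y , L z , subst (map L S ↭_) (map-shape₇ L L-+ x y z) (↭-map⁺ L S↭)

All-preimage⇒map : ∀ {A B : Set} (f : A → B) {S} → All (λ s → ∃[ a ] f a ≡ s) S → ∃[ S′ ] map f S′ ≡ S
All-preimage⇒map f []                      = [] , refl
All-preimage⇒map f ((a , fa≡s) ∷ preimages) with S′ , eq ← All-preimage⇒map f preimages =
  a ∷ S′ , cong₂ _∷_ fa≡s eq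

e₁ e₂ e₃ : V 3
e₁ = true ∷ false ∷ false ∷ []
e₂ = false ∷ true ∷ false ∷ []
e₃ = false ∷ false ∷ true ∷ []

nonzero₃ : List (V 3)
nonzero₃ = shape₇ e₁ e₂ e₃

∈nonzero₃ : ∀ {t} → t ≢ 𝟘 → t ∈ nonzero₃
∈nonzero₃ {false ∷ false ∷ false ∷ []} t≢𝟘 = contradiction refl t≢𝟘
∈nonzero₃ {true  ∷ false ∷ false ∷ []} _ = here refl
∈nonzero₃ {false ∷ true  ∷ false ∷ []} _ = there (here refl)
∈nonzero₃ {false ∷ false ∷ true  ∷ []} _ = there (there (here refl))
∈nonzero₃ {true  ∷ true  ∷ false ∷ []} _ = there (there (there (here refl)))
∈nonzero₃ {false ∷ true  ∷ true  ∷ []} _ = there (there (there (there (here refl))))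
∈nonzero₃ {true  ∷ false ∷ true  ∷ []} _ = there (there (there (there (there (here refl)))))
∈nonzero₃ {true  ∷ true  ∷ true  ∷ []} _ = there (there (there (there (there (there (here refl))))))

nonzero₃-unique : Unique nonzero₃
nonzero₃-unique = from-yes (unique? nonzero₃)
  where open import Data.List.Relation.Unary.Unique.DecPropositional (_≟V_ {3}) using (unique?)

nonzero₃-≢𝟘 : All (_≢ 𝟘) nonzero₃
nonzero₃-≢𝟘 = from-yes (all? (λ t → ¬? (t ≟V 𝟘)) nonzero₃)

∈allV : ∀ n (v : V n) → v ∈ allV n
∈allV zero    []          = here refl
∈allV (suc n) (false ∷ v) = ∈-++⁺ˡ (∈-map⁺ (false ∷_) (∈allV n v))
∈allV (suc n) (true ∷ v)  = ∈-++⁺ʳ (map (false ∷_) (allV n)) (∈-map⁺ (true ∷_) (∈allV n v))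

outside : V 3 → V 3 → V 3
outside p q = fromMaybe 𝟘 (List.head (filter (λ y → ¬? (y ∈? spanList (p ∷ q ∷ []))) (allV 3)))
  where open import Data.List.Membership.DecPropositional (_≟V_ {3}) using (_∈?_)

-- For distinct nonzero p, q, the nonzero vectors of 𝔽₂³ other than p and q are p + q and the coset
-- y + ⟨p, q⟩ of any y ∉ ⟨p, q⟩; checked exhaustively.
complement-shape₅ : ∀ p q t → p ≢ q → p ≢ 𝟘 → q ≢ 𝟘 → t ≢ 𝟘 → t ≢ p → t ≢ q →
  t ∈ shape₅ (p +V q) (outside p q) (p +V outside p q)
complement-shape₅ p q t = All.lookup (All.lookup (All.lookup table (∈allV 3 p)) (∈allV 3 q)) (∈allV 3 t)
  where
    open import Data.List.Membership.DecPropositional (_≟V_ {3}) using (_∈?_)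
    Claim : V 3 → V 3 → V 3 → Set
    Claim p q t = p ≢ q → p ≢ 𝟘 → q ≢ 𝟘 → t ≢ 𝟘 → t ≢ p → t ≢ q →
      t ∈ shape₅ (p +V q) (outside p q) (p +V outside p q)
    claim? : ∀ p q t → Dec (Claim p q t)
    claim? p q t = ¬? (p ≟V q) →-dec ¬? (p ≟V 𝟘) →-dec ¬? (q ≟V 𝟘) →-dec ¬? (t ≟V 𝟘) →-dec ¬? (t ≟V p)
                   →-dec ¬? (t ≟V q) →-dec (t ∈? shape₅ (p +V q) (outside p q) (p +V outside p q))
    table : All (λ p → All (λ q → All (Claim p q) (allV 3)) (allV 3)) (allV 3)
    table = from-yes (all? (λ p → all? (λ q → all? (claim? p q) (allV 3)) (allV 3)) (allV 3))

module _ {S : List (V 3)} (uniqS : Unique S) (S≢𝟘 : All (_≢ 𝟘) S) where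

  length≤7 : length S ℕ.≤ 7
  length≤7 = Unique-⊆⇒length≤ uniqS (∈nonzero₃ ∘ All.lookup S≢𝟘)

  length≡7⇒Form₇ : length S ≡ 7 → Form₇ S
  length≡7⇒Form₇ len≡7 = e₁ , e₂ , e₃ , Unique-⊆⇒↭ uniqS (∈nonzero₃ ∘ All.lookup S≢𝟘) (≤-reflexive (sym len≡7))

  length≡5⇒Form₅ : length S ≡ 5 → Form₅ S
  length≡5⇒Form₅ len≡5
    with p , p∈nonzero , p∉S ← ∃-∉-of-longer _≟V_ nonzero₃-unique (subst (ℕ._< 7) (sym len≡5) (ℕP.n≤1+n 6))
    with q , q∈nonzero , q∉p∷S ← ∃-∉-of-longer _≟V_ nonzero₃-unique
                                    (subst (λ k → suc k ℕ.< 7) (sym len≡5) ≤-refl) =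
    p +V q , outside p q , p +V outside p q , Unique-⊆⇒↭ uniqS S⊆shape (≤-reflexive (sym len≡5))
    where
      ≢𝟘 : ∀ {t} → t ∈ nonzero₃ → t ≢ 𝟘
      ≢𝟘 = All.lookup nonzero₃-≢𝟘
      S⊆shape : S ⊆ shape₅ (p +V q) (outside p q) (p +V outside p q)
      S⊆shape {t} t∈S = complement-shape₅ p q t (λ p≡q → q∉p∷S (here (sym p≡q))) (≢𝟘 p∈nonzero) (≢𝟘 q∈nonzero)
        (All.lookup S≢𝟘 t∈S) (λ { refl → p∉S t∈S }) (λ { refl → q∉p∷S (there t∈S) })

odd-between-4-and-7 : ∀ k → k % 2 ≡ 1 → 4 ℕ.≤ k → k ℕ.≤ 7 → k ≡ 5 ⊎ k ≡ 7
odd-between-4-and-7 5 _ _ _ = inj₁ refl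
odd-between-4-and-7 7 _ _ _ = inj₂ refl
odd-between-4-and-7 0 () _ _
odd-between-4-and-7 1 _ (s≤s ()) _
odd-between-4-and-7 2 () _ _
odd-between-4-and-7 3 _ (s≤s (s≤s (s≤s ()))) _
odd-between-4-and-7 4 () _ _
odd-between-4-and-7 6 () _ _
odd-between-4-and-7 (suc (suc (suc (suc (suc (suc (suc (suc _))))))))
  _ _ (s≤s (s≤s (s≤s (s≤s (s≤s (s≤s (s≤s ())))))))

module _ {n} (G : Vec (V n) 3) where

  image-Form₅⊎Form₇ : ∀ {S : List (V 3)} → Unique S → All (_≢ 𝟘) S → length S % 2 ≡ 1 → 4 ℕ.≤ length S →
    Form₅ (map (λ t → lincomb t G) S) ⊎ Form₇ (map (λ t → lincomb t G) S)
  image-Form₅⊎Form₇ {S} uniqS S≢𝟘 odd 4≤len with odd-between-4-and-7 (length S) odd 4≤len (length≤7 uniqS S≢𝟘)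
  ... | inj₁ len≡5 = inj₁ (map⁺-Form₅ _ (λ s t → lincomb-+ s t G) (length≡5⇒Form₅ uniqS S≢𝟘 len≡5))
  ... | inj₂ len≡7 = inj₂ (map⁺-Form₇ _ (λ s t → lincomb-+ s t G) (length≡7⇒Form₇ uniqS S≢𝟘 len≡7))

  ⊆span⇒Form₅⊎Form₇ : ∀ {S} → Unique S → All (_≢ 𝟘) S → S ⊆ spanList (toList G) →
    length S % 2 ≡ 1 → 4 ℕ.≤ length S → Form₅ S ⊎ Form₇ S
  ⊆span⇒Form₅⊎Form₇ uniqS S≢𝟘 S⊆span odd 4≤len
    with S′ , refl ← All-preimage⇒map (λ t → lincomb t G) (All.tabulate (∈span⇒lincomb G ∘ S⊆span))
    rewrite length-map (λ t → lincomb t G) S′ =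
    image-Form₅⊎Form₇ (UniqP.map⁻ uniqS) S′≢𝟘 odd 4≤len
    where S′≢𝟘 = All.map (λ Lt≢𝟘 t≡𝟘 → Lt≢𝟘 (trans (cong (λ t → lincomb t G) t≡𝟘) (lincomb-𝟘 G))) (All-map⁻ S≢𝟘)

rank≥4⊎⊆three : ∀ {n} (B : List (V n)) → 4 ℕ.≤ length B ⊎ ∃[ G ] B ⊆ toList {n = 3} G
rank≥4⊎⊆three (_ ∷ _ ∷ _ ∷ _ ∷ _) = inj₁ (s≤s (s≤s (s≤s (s≤s z≤n))))
rank≥4⊎⊆three []                  = inj₂ (𝟘 ∷ 𝟘 ∷ 𝟘 ∷ [] , λ ())
rank≥4⊎⊆three (c ∷ [])            = inj₂ (𝟘 ∷ 𝟘 ∷ c ∷ [] , there ∘ there)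
rank≥4⊎⊆three (b ∷ c ∷ [])        = inj₂ (𝟘 ∷ b ∷ c ∷ [] , there)
rank≥4⊎⊆three (a ∷ b ∷ c ∷ [])    = inj₂ (a ∷ b ∷ c ∷ [] , λ a∈ → a∈)

-- Goals mentioning q0 are split by helper functions rather than with-abstraction, which would normalise
-- the rational constants in the goal and make type checking very slow.
m≡0-odd⇒small-or-Form : ∀ {n} (S : List (V n)) → Unique S → All (_≢ 𝟘) S → m S ≡ 0 → length S % 2 ≡ 1 →
  q0 S ≤ + 1 / 16 ⊎ Form₃ S ⊎ Form₅ S ⊎ Form₇ S
m≡0-odd⇒small-or-Form (s ∷ []) _ (s≢𝟘 ∷ _) m≡0 _ = contradiction m≡0 (m[s]≢0 s s≢𝟘)
m≡0-odd⇒small-or-Form (_ ∷ _ ∷ _ ∷ []) uniqS (s₁≢𝟘 ∷ _) m≡0 _ = inj₂ (inj₁ (m≡0⇒Form₃ uniqS s₁≢𝟘 m≡0))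
m≡0-odd⇒small-or-Form S@(_ ∷ _ ∷ _ ∷ _ ∷ _) uniqS S≢𝟘 _ odd = from-basis (basis S)
  where
    from-basis : ∃[ B ] (Independent B × B ⊆ S × S ⊆ spanList B) → q0 S ≤ + 1 / 16 ⊎ Form₃ S ⊎ Form₅ S ⊎ Form₇ S
    from-basis (B , indB , B⊆S , S⊆spanB) = [ inj₁ ∘ large , (λ G → inj₂ (inj₂ (small G))) ]′ (rank≥4⊎⊆three B)
      where
        large : 4 ℕ.≤ length B → q0 S ≤ + 1 / 16
        large 4≤|B| = q0-≤-independent 15 indB B⊆S (ℕP.^-monoʳ-≤ 2 4≤|B|)
        small : ∃[ G ] B ⊆ toList G → Form₅ S ⊎ Form₇ S
        small (G , B⊆G) = ⊆span⇒Form₅⊎Form₇ G uniqS S≢𝟘 (span-⊆ B (toList G) (∈⇒∈span ∘ B⊆G) ∘ S⊆spanB)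
                            odd (s≤s (s≤s (s≤s (s≤s z≤n))))

[]⊎∈ : ∀ {A : Set} (xs : List A) → xs ≡ [] ⊎ ∃[ x ] x ∈ xs
[]⊎∈ []      = inj₁ refl
[]⊎∈ (x ∷ _) = inj₂ (x , here refl)

∈J⇒q0-J≤¼ : ∀ {n} {S : List (V n)} → Unique S → All (_≢ 𝟘) S → ∀ {v} → v ∈ J S → q0 (J S) ≤ + 1 / 4
∈J⇒q0-J≤¼ {S = S} uniqS S≢𝟘 {v} v∈J = from-second (J-second uniqS S≢𝟘 v∈J)
  where
    ≢𝟘 : ∀ {w} → w ∈ J S → w ≢ 𝟘
    ≢𝟘 = All.lookup S≢𝟘 ∘ proj₁ ∘ ∈J⁻ {S = S}
    from-second : ∃[ u ] (u ∈ J S × u ≢ v) → q0 (J S) ≤ + 1 / 4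
    from-second (u , u∈J , u≢v) = q0-≤¼ (J S) u∈J v∈J u≢v (≢𝟘 u∈J) (≢𝟘 v∈J)

lemma5p4 : (n : ℕ) (S : List (V n)) → Unique S → All (λ v → v ≢ 𝟘) S →
  ((q0 {n} [] ≡ 1ℚ)
    × (∀ (x : V n) → x ≢ 𝟘 → q0 (x ∷ []) ≡ ½)
    × (2 Data.Nat.≤ length S → q0 S ≤ (+ 1 / 4)))
  × (m S ≡ 0 → length S % 2 ≡ 1 →
      (q0 S ≤ (+ 1 / 16))
      ⊎ (∃[ x ] ∃[ y ] (S ↭ (x ∷ y ∷ (x +V y) ∷ [])))
      ⊎ (∃[ x ] ∃[ y ] ∃[ z ] (S ↭ (x ∷ y ∷ z ∷ (x +V y) ∷ (x +V z) ∷ [])))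
      ⊎ (∃[ x ] ∃[ y ] ∃[ z ]
           (S ↭ (x ∷ y ∷ z ∷ (x +V y) ∷ (y +V z) ∷ (x +V z) ∷ (x +V y +V z) ∷ []))))
  × (J S ≡ [] ⊎ q0 (J S) ≤ (+ 1 / 4))
lemma5p4 n S uniqS S≢𝟘 =
  (q0-[] n , q0-[x] , q0-≤¼-of-length≥2 S uniqS S≢𝟘) ,
  m≡0-odd⇒small-or-Form S uniqS S≢𝟘 ,
  Sum.map₂ (λ (_ , v∈J) → ∈J⇒q0-J≤¼ uniqS S≢𝟘 v∈J) ([]⊎∈ (J S))
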